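{- For every $n\in\mathbb{N}$ there exists a rooted tree $S_n$ with at most $n^2$ vertices which is an NCA-universal tree for the family of rooted binary trees with at most $n$ vertices.
   Context: In a rooted tree $T$, a vertex $u$ is an ancestor of $v$ if $u$ lies on the unique path from $v$ to the root (so $u$ is an ancestor of itself); $\mathrm{nca}_T(u,v)$ is the common ancestor of $u,v$ furthest from the root. A rooted binary tree is one in which every vertex has at most two children. A rooted tree $S$ is an NCA-universal tree for a family $\mathcal{T}$ of rooted trees if for every $T\in\mathcal{T}$ there is an injective map $\varphi_T:V(T)\to V(S)$ with $\varphi_T(\mathrm{nca}_T(u,v))=\mathrm{nca}_S(\varphi_T(u),\varphi_T(v))$ for all $u,v\in V(T)$; the root of $T$ need not be mapped to the root of $S$. -}

module Defs where

open import Data.Nat using (ℕ; zero; suc; _+_; _≤_)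
open import Data.List using (List; []; _∷_; length; lookup)
open import Data.List.Relation.Unary.All using (All)
open import Data.Fin using (Fin; _≟_)
open import Relation.Nullary using (yes; no)
open import Relation.Binary.PropositionalEquality using (_≡_; refl)

data Tree : Set where
  node : List Tree → Tree

-- Vertices of a tree t, represented as paths from the root.
data Pos : Tree → Set where
  root  : ∀ {t} → Pos t
  child : ∀ {ts} (i : Fin (length ts)) → Pos (lookup ts i) → Pos (node ts)

mutual
  size : Tree → ℕ
  size (node ts) = suc (sizes ts)

  sizes : List Tree → ℕ
  sizes []       = 0
  sizes (t ∷ ts) = size t + sizes ts

data _≼_ : ∀ {t} → Pos t → Pos t → Set where
  root≼  : ∀ {t} {v : Pos t} → root ≼ v
  child≼ : ∀ {ts} {i : Fin (length ts)} {u v : Pos (lookup ts i)} →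
           u ≼ v → _≼_ {node ts} (child i u) (child i v)

nca : ∀ {t} → Pos t → Pos t → Pos t
nca root          _             = root
nca (child i u)   root          = root
nca (child i u)   (child j v) with i ≟ j
... | yes refl = child i (nca u v)
... | no  _    = root

data Binary : Tree → Set where
  bin : ∀ {ts} → length ts ≤ 2 → All Binary ts → Binary (node ts)

-- NCA-preserving injective embedding of T into S (root of T need not go to root of S).
record NCAEmbedding (T S : Tree) : Set where
  field
    φ         : Pos T → Pos S
    injective : ∀ u v → φ u ≡ φ v → u ≡ v
    nca-pres  : ∀ u v → φ (nca u v) ≡ nca (φ u) (φ v)

NCAUniversalBinary : ℕ → Tree → Set
NCAUniversalBinary n S = ∀ T → Binary T → size T ≤ n → NCAEmbedding T S

module Submission where

open import Defs
open import Data.Nat using (ℕ; zero; suc; _+_; _*_; _≤_; _<_; z≤n; s≤s; _≤?_; _<?_; ⌊_/2⌋; ⌈_/2⌉)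
open import Data.Nat.Properties hiding (_≟_)
open import Data.Nat.Tactic.RingSolver using (solve-∀)
open import Data.Fin using (Fin; zero; suc; _≟_)
open import Data.List using ([]; _∷_; length; lookup)
open import Data.List.Relation.Unary.All using ([]; _∷_)
open import Data.Product using (Σ; ∃-syntax; _×_; _,_)
open import Data.Sum using (_⊎_; inj₁; inj₂)
open import Data.Empty using (⊥-elim)
open import Function using (_∘_)
open import Function.Definitions using (Injective)
open import Relation.Nullary using (yes; no)
open import Relation.Binary.PropositionalEquality using (_≡_; _≢_; refl; sym; trans; cong; subst)

-- Descend from the root of a binary tree T with k + 1 vertices into a child with more
-- than ⌈k/2⌉ vertices as long as there is one.  The vertices hanging off this path weigh
-- at most ⌊k/2⌋ in total, and its last vertex has only children with at most ⌈k/2⌉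
-- vertices.  Hence S_{k+1} = Q_{⌊k/2⌋} (node [S_c , S_c]) with c = ⌈k/2⌉ works, where
-- Q_m X hosts every such path of weight at most m followed by a tree embeddable in X:
-- Q_{m+1} X = Q_{⌊m/2⌋} (node [S_m , Q_{⌈m/2⌉} X]), the path being cut at the step that
-- crosses weight ⌊m/2⌋, whose off-path subtree has at most m vertices and goes to S_m.
-- Then |Q_m X| ≤ 2m² + |X| and |S_n| ≤ n², both because 2(⌊m/2⌋² + ⌈m/2⌉²) ≤ m² + m.

child-index : ∀ {ts} {i j : Fin (length ts)} {x y} → child {ts} i x ≡ child j y → i ≡ j
child-index refl = refl

child-injective : ∀ {ts} {i : Fin (length ts)} {x y} → child {ts} i x ≡ child i y → x ≡ y
child-injective refl = refl

nca-child-same : ∀ {ts} (i : Fin (length ts)) (x y : Pos (lookup ts i)) →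
                 nca {node ts} (child i x) (child i y) ≡ child i (nca x y)
nca-child-same i x y with i ≟ i
... | yes refl = refl
... | no i≢i   = ⊥-elim (i≢i refl)

nca-child-distinct : ∀ {ts} {i j : Fin (length ts)} (x : Pos (lookup ts i)) (y : Pos (lookup ts j)) →
                     i ≢ j → nca {node ts} (child i x) (child j y) ≡ root
nca-child-distinct {i = i} {j} x y i≢j with i ≟ j
... | yes i≡j = ⊥-elim (i≢j i≡j)
... | no _    = refl

leaf-embedding : ∀ S → NCAEmbedding (node []) S
leaf-embedding S = record { φ = λ _ → root ; injective = injective ; nca-pres = λ _ _ → refl }
  where
  injective : (u v : Pos (node [])) → root ≡ root → u ≡ v
  injective root root _ = refl

child-embedding : ∀ {T ss} (i : Fin (length ss)) → NCAEmbedding T (lookup ss i) → NCAEmbedding T (node ss)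
child-embedding i e = record
  { φ         = child i ∘ φ
  ; injective = λ u v → injective u v ∘ child-injective
  ; nca-pres  = λ u v → trans (cong (child i) (nca-pres u v)) (sym (nca-child-same i (φ u) (φ v)))
  }
  where open NCAEmbedding e

node-embedding : ∀ {ts ss} (σ : Fin (length ts) → Fin (length ss)) → Injective _≡_ _≡_ σ →
                 (∀ k → NCAEmbedding (lookup ts k) (lookup ss (σ k))) → NCAEmbedding (node ts) (node ss)
node-embedding {ts} {ss} σ σ-injective e = record { φ = φ ; injective = injective ; nca-pres = nca-pres }
  where
  module E k = NCAEmbedding (e k)

  φ : Pos (node ts) → Pos (node ss)
  φ root        = root
  φ (child k u) = child (σ k) (E.φ k u)

  injective : ∀ u v → φ u ≡ φ v → u ≡ v
  injective root        root        _ = refl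
  injective (child k u) (child l v) eq with σ-injective (child-index eq)
  ... | refl = cong (child k) (E.injective k u v (child-injective eq))

  nca-pres : ∀ u v → φ (nca u v) ≡ nca (φ u) (φ v)
  nca-pres root        _           = refl
  nca-pres (child k u) root        = refl
  nca-pres (child k u) (child l v) with k ≟ l
  ... | yes refl = trans (cong (child (σ k)) (E.nca-pres k u v)) (sym (nca-child-same (σ k) _ _))
  ... | no k≢l   = sym (nca-child-distinct _ _ (k≢l ∘ σ-injective))

node₁-embedding : ∀ {A ss} (i : Fin (length ss)) → NCAEmbedding A (lookup ss i) →
                  NCAEmbedding (node (A ∷ [])) (node ss)
node₁-embedding i e = node-embedding (λ _ → i) injective (λ { zero → e })
  where
  injective : Injective _≡_ _≡_ (λ (_ : Fin 1) → i)
  injective {zero} {zero} _ = refl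

node₂-embedding : ∀ {A B ss} (i j : Fin (length ss)) → i ≢ j →
                  NCAEmbedding A (lookup ss i) → NCAEmbedding B (lookup ss j) →
                  NCAEmbedding (node (A ∷ B ∷ [])) (node ss)
node₂-embedding i j i≢j eA eB = node-embedding σ injective (λ { zero → eA ; (suc zero) → eB })
  where
  σ : Fin 2 → _
  σ zero       = i
  σ (suc zero) = j

  injective : Injective _≡_ _≡_ σ
  injective {zero}     {zero}     _  = refl
  injective {zero}     {suc zero} eq = ⊥-elim (i≢j eq)
  injective {suc zero} {zero}     eq = ⊥-elim (i≢j (sym eq))
  injective {suc zero} {suc zero} _  = refl

size-node₁ : ∀ A → size (node (A ∷ [])) ≡ suc (size A)
size-node₁ A = cong suc (+-identityʳ (size A))

size-node₂ : ∀ A B → size (node (A ∷ B ∷ [])) ≡ suc (size A + size B)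
size-node₂ A B = cong (λ n → suc (size A + n)) (+-identityʳ (size B))

-- Descent T R w: a downward path from the root of T to its subtree R, where w counts the
-- vertices of T outside R, i.e. the path vertices together with their off-path subtrees.
data Step : Tree → Tree → ℕ → Set where
  onlyChild  : ∀ {T} → Step (node (T ∷ [])) T 1
  rightChild : ∀ {P T} → Binary P → Step (node (P ∷ T ∷ [])) T (suc (size P))
  leftChild  : ∀ {P T} → Binary P → Step (node (T ∷ P ∷ [])) T (suc (size P))

data Descent : Tree → Tree → ℕ → Set where
  []  : ∀ {R} → Descent R R 0
  _∷_ : ∀ {T T′ R k w} → Step T T′ k → Descent T′ R w → Descent T R (k + w)

descent-weight-zero : ∀ {T R w} → Descent T R w → w ≤ 0 → T ≡ R
descent-weight-zero []                _  = refl
descent-weight-zero (onlyChild    ∷ _) ()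
descent-weight-zero (rightChild _ ∷ _) ()
descent-weight-zero (leftChild _  ∷ _) ()

data SmallChildren (c : ℕ) : Tree → Set where
  none : SmallChildren c (node [])
  one  : ∀ {A} → Binary A → size A ≤ c → SmallChildren c (node (A ∷ []))
  two  : ∀ {A B} → Binary A → Binary B → size A ≤ c → size B ≤ c → SmallChildren c (node (A ∷ B ∷ []))

data HeavyDescent (a c : ℕ) (T : Tree) : Set where
  heavyDescent : ∀ {R w} → Descent T R w → w ≤ a → SmallChildren c R → HeavyDescent a c T

split-budget : ∀ k {s a C} → k + s ≤ a + C → C ≤ s → ∃[ a′ ] k + a′ ≡ a × s ≤ a′ + C
split-budget k {s} {a} {C} k+s≤a+C C≤s with m≤n⇒∃[o]m+o≡n k≤a
  where
  k≤a : k ≤ a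
  k≤a = +-cancelʳ-≤ s k a (≤-trans k+s≤a+C (+-monoʳ-≤ a C≤s))
... | a′ , refl = a′ , refl , +-cancelˡ-≤ k s (a′ + C) (subst (k + s ≤_) (+-assoc k a′ C) k+s≤a+C)

descend-into : ∀ {a c T X k} → Step T X k → k + size X ≤ a + suc c → c < size X →
               (∀ {a′} → size X ≤ a′ + suc c → HeavyDescent a′ c X) → HeavyDescent a c T
descend-into {a} {c} {k = k} step fits heavy descend with split-budget k {a = a} fits heavy
... | a′ , refl , fits′ with descend fits′
...   | heavyDescent path w≤a′ small = heavyDescent (step ∷ path) (+-monoʳ-≤ k w≤a′) small

heavy-descent : ∀ a c {T} → Binary T → size T ≤ a + suc c → HeavyDescent a c T
heavy-descent a c (bin {[]} _ []) _ = heavyDescent [] z≤n none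
heavy-descent a c (bin {A ∷ []} _ (bA ∷ [])) fits with size A ≤? c
... | yes A≤c = heavyDescent [] z≤n (one bA A≤c)
... | no  A≰c = descend-into onlyChild (subst (_≤ a + suc c) (size-node₁ A) fits) (≰⇒> A≰c)
                  (heavy-descent _ c bA)
heavy-descent a c (bin {A ∷ B ∷ []} _ (bA ∷ bB ∷ [])) fits with size A ≤? c | size B ≤? c
... | yes A≤c | yes B≤c = heavyDescent [] z≤n (two bA bB A≤c B≤c)
... | _       | no  B≰c = descend-into (rightChild bA) (subst (_≤ a + suc c) (size-node₂ A B) fits)
                            (≰⇒> B≰c) (heavy-descent _ c bB)
... | no  A≰c | yes _   = descend-into (leftChild bB)
                            (subst (_≤ a + suc c) (trans (size-node₂ A B) (cong suc (+-comm (size A) (size B)))) fits)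
                            (≰⇒> A≰c) (heavy-descent _ c bA)
heavy-descent a c (bin {_ ∷ _ ∷ _ ∷ _} (s≤s (s≤s ())) _) _

data Split (a b : ℕ) (T R : Tree) : Set where
  split : ∀ {M N w₁ k w₂} → Descent T M w₁ → w₁ ≤ a → Step M N k → k ≤ suc (a + b) →
          Descent N R w₂ → w₂ ≤ b → Split a b T R

split-descent : ∀ a b {T R w} → Descent T R w → a < w → w ≤ suc (a + b) → Split a b T R
split-descent a b (_∷_ {k = k} {w = w} step path) a<k+w k+w≤ with a <? k
... | yes a<k = split [] z≤n step (≤-trans (m≤m+n k w) k+w≤) path
                  (+-cancelˡ-≤ (suc a) w b (≤-trans (+-monoˡ-≤ w a<k) k+w≤))
... | no  a≮k with m≤n⇒∃[o]m+o≡n (≮⇒≥ a≮k)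
...   | a′ , refl with split-descent a′ b path (+-cancelˡ-< k a′ w a<k+w) (+-cancelˡ-≤ k w (suc (a′ + b)) k+w≤′)
  where
  k+w≤′ : k + w ≤ k + suc (a′ + b)
  k+w≤′ = subst (k + w ≤_) (trans (cong suc (+-assoc k a′ b)) (sym (+-suc k (a′ + b)))) k+w≤
...     | split before w₁≤a′ mid k′≤ after w₂≤b =
          split (step ∷ before) (+-monoʳ-≤ k w₁≤a′) mid (≤-trans k′≤ (s≤s (+-monoˡ-≤ b (m≤n+m a′ k))))
                after w₂≤b

halves-suc : ∀ k → suc k ≡ ⌊ k /2⌋ + suc ⌈ k /2⌉
halves-suc k = sym (trans (+-suc ⌊ k /2⌋ ⌈ k /2⌉) (cong suc (⌊n/2⌋+⌈n/2⌉≡n k)))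

-- The first argument of each construction is fuel: the definitions are the intended ones
-- whenever the fuel is at least the size parameter, which is all that is used below.
mutual
  universal : ℕ → ℕ → Tree
  universal zero    _       = node []
  universal (suc f) zero    = node []
  universal (suc f) (suc k) = spine f ⌊ k /2⌋ (bottom f ⌈ k /2⌉)

  bottom : ℕ → ℕ → Tree
  bottom f zero    = node []
  bottom f (suc c) = node (universal f (suc c) ∷ universal f (suc c) ∷ [])

  spine : ℕ → ℕ → Tree → Tree
  spine zero    _       X = X
  spine (suc f) zero    X = X
  spine (suc f) (suc m) X = spine f ⌊ m /2⌋ (node (universal f m ∷ spine f ⌈ m /2⌉ X ∷ []))

spine-end-embedding : ∀ f m {R} X → NCAEmbedding R X → NCAEmbedding R (spine f m X)
spine-end-embedding zero    _       X e = e
spine-end-embedding (suc f) zero    X e = e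
spine-end-embedding (suc f) (suc m) X e =
  spine-end-embedding f ⌊ m /2⌋ _ (child-embedding (suc zero) (spine-end-embedding f ⌈ m /2⌉ X e))

mutual
  universal-embedding : ∀ f n {T} → n ≤ f → Binary T → size T ≤ n → NCAEmbedding T (universal f n)
  universal-embedding f       zero    _         (bin _ _) ()
  universal-embedding (suc f) (suc k) {T} (s≤s k≤f) bT fits
    with heavy-descent ⌊ k /2⌋ ⌈ k /2⌉ bT (subst (size T ≤_) (halves-suc k) fits)
  ... | heavyDescent path w≤ small =
        spine-embedding f ⌊ k /2⌋ _ (≤-trans (⌊n/2⌋≤n k) k≤f) path w≤
          (bottom-embedding f ⌈ k /2⌉ (≤-trans (⌈n/2⌉≤n k) k≤f) small)

  bottom-embedding : ∀ f c {R} → c ≤ f → SmallChildren c R → NCAEmbedding R (bottom f c)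
  bottom-embedding f c       _   none                 = leaf-embedding _
  bottom-embedding f zero    _   (one (bin _ _) ())
  bottom-embedding f zero    _   (two (bin _ _) _ () _)
  bottom-embedding f (suc c) c≤f (one bA A≤c)         = node₁-embedding zero (universal-embedding f _ c≤f bA A≤c)
  bottom-embedding f (suc c) c≤f (two bA bB A≤c B≤c)  =
    node₂-embedding zero (suc zero) (λ ()) (universal-embedding f _ c≤f bA A≤c) (universal-embedding f _ c≤f bB B≤c)

  step-embedding : ∀ f m {M N k Y} → m ≤ f → Step M N k → k ≤ suc m → NCAEmbedding N Y →
                   NCAEmbedding M (node (universal f m ∷ Y ∷ []))
  step-embedding f m m≤f onlyChild         _         e = node₁-embedding (suc zero) e
  step-embedding f m m≤f (rightChild bP) (s≤s P≤m) e =
    node₂-embedding zero (suc zero) (λ ()) (universal-embedding f m m≤f bP P≤m) e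
  step-embedding f m m≤f (leftChild bP)  (s≤s P≤m) e =
    node₂-embedding (suc zero) zero (λ ()) e (universal-embedding f m m≤f bP P≤m)

  spine-embedding : ∀ f m {T R w} X → m ≤ f → Descent T R w → w ≤ m → NCAEmbedding R X →
                    NCAEmbedding T (spine f m X)
  spine-embedding zero m X m≤0 path w≤m e with descent-weight-zero path (≤-trans w≤m m≤0)
  ... | refl = e
  spine-embedding (suc f) zero X _ path w≤0 e with descent-weight-zero path w≤0
  ... | refl = e
  spine-embedding (suc f) (suc m) {w = w} X (s≤s m≤f) path w≤ e with w ≤? ⌊ m /2⌋
  ... | yes w≤a = spine-embedding f ⌊ m /2⌋ _ (≤-trans (⌊n/2⌋≤n m) m≤f) path w≤a
                    (child-embedding (suc zero) (spine-end-embedding f ⌈ m /2⌉ X e))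
  ... | no  w≰a with split-descent ⌊ m /2⌋ ⌈ m /2⌉ path (≰⇒> w≰a)
                       (subst (λ n → w ≤ suc n) (sym (⌊n/2⌋+⌈n/2⌉≡n m)) w≤)
  ...   | split before w₁≤a mid k≤ after w₂≤b =
          spine-embedding f ⌊ m /2⌋ _ (≤-trans (⌊n/2⌋≤n m) m≤f) before w₁≤a
            (step-embedding f m m≤f mid (subst (λ n → _ ≤ suc n) (⌊n/2⌋+⌈n/2⌉≡n m) k≤)
              (spine-embedding f ⌈ m /2⌉ X (≤-trans (⌈n/2⌉≤n m) m≤f) after w₂≤b e))

⌈n/2⌉≡⌊n/2⌋⊎⌈n/2⌉≡1+⌊n/2⌋ : ∀ n → ⌈ n /2⌉ ≡ ⌊ n /2⌋ ⊎ ⌈ n /2⌉ ≡ suc ⌊ n /2⌋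
⌈n/2⌉≡⌊n/2⌋⊎⌈n/2⌉≡1+⌊n/2⌋ zero          = inj₁ refl
⌈n/2⌉≡⌊n/2⌋⊎⌈n/2⌉≡1+⌊n/2⌋ (suc zero)    = inj₂ refl
⌈n/2⌉≡⌊n/2⌋⊎⌈n/2⌉≡1+⌊n/2⌋ (suc (suc n)) with ⌈n/2⌉≡⌊n/2⌋⊎⌈n/2⌉≡1+⌊n/2⌋ n
... | inj₁ eq = inj₁ (cong suc eq)
... | inj₂ eq = inj₂ (cong suc eq)

balanced-squares : ∀ a b → b ≡ a ⊎ b ≡ suc a → 2 * (a * a + b * b) ≤ (a + b) * (a + b) + (a + b)
balanced-squares a _ (inj₁ refl) = subst (2 * (a * a + a * a) ≤_) (sym (even a)) (m≤m+n _ (a + a))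
  where
  even : ∀ a → (a + a) * (a + a) + (a + a) ≡ 2 * (a * a + a * a) + (a + a)
  even = solve-∀
balanced-squares a _ (inj₂ refl) = subst (2 * (a * a + suc a * suc a) ≤_) (sym (odd a)) (m≤m+n _ (a + a))
  where
  odd : ∀ a → (a + suc a) * (a + suc a) + (a + suc a) ≡ 2 * (a * a + suc a * suc a) + (a + a)
  odd = solve-∀

halves-squares : ∀ m → 2 * (⌊ m /2⌋ * ⌊ m /2⌋ + ⌈ m /2⌉ * ⌈ m /2⌉) ≤ m * m + m
halves-squares m = subst (λ n → 2 * (⌊ m /2⌋ * ⌊ m /2⌋ + ⌈ m /2⌉ * ⌈ m /2⌉) ≤ n * n + n) (⌊n/2⌋+⌈n/2⌉≡n m)
                     (balanced-squares ⌊ m /2⌋ ⌈ m /2⌉ (⌈n/2⌉≡⌊n/2⌋⊎⌈n/2⌉≡1+⌊n/2⌋ m))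

universal-size-step : ∀ k a b → 2 * (a * a + b * b) ≤ k * k + k → 2 * (a * a) + suc (2 * (b * b)) ≤ suc k * suc k
universal-size-step k a b squares = begin
  2 * (a * a) + suc (2 * (b * b)) ≡⟨ regroup a b ⟩
  2 * (a * a + b * b) + 1         ≤⟨ +-monoˡ-≤ 1 squares ⟩
  k * k + k + 1                   ≤⟨ m≤m+n _ k ⟩
  k * k + k + 1 + k               ≡⟨ expand k ⟩
  suc k * suc k                   ∎
  where
  open ≤-Reasoning
  regroup : ∀ a b → 2 * (a * a) + suc (2 * (b * b)) ≡ 2 * (a * a + b * b) + 1
  regroup = solve-∀
  expand : ∀ k → k * k + k + 1 + k ≡ suc k * suc k
  expand = solve-∀

spine-size-step : ∀ m a b x → 2 * (a * a + b * b) ≤ m * m + m →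
                  2 * (a * a) + suc ((m * m + 1) + (2 * (b * b) + x)) ≤ 2 * (suc m * suc m) + x
spine-size-step m a b x squares = begin
  2 * (a * a) + suc ((m * m + 1) + (2 * (b * b) + x)) ≡⟨ regroup m a b x ⟩
  2 * (a * a + b * b) + (m * m + 2 + x)               ≤⟨ +-monoˡ-≤ (m * m + 2 + x) squares ⟩
  m * m + m + (m * m + 2 + x)                         ≤⟨ m≤m+n _ (3 * m) ⟩
  m * m + m + (m * m + 2 + x) + 3 * m                 ≡⟨ expand m x ⟩
  2 * (suc m * suc m) + x                             ∎
  where
  open ≤-Reasoning
  regroup : ∀ m a b x → 2 * (a * a) + suc ((m * m + 1) + (2 * (b * b) + x)) ≡ 2 * (a * a + b * b) + (m * m + 2 + x)
  regroup = solve-∀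
  expand : ∀ m x → m * m + m + (m * m + 2 + x) + 3 * m ≡ 2 * (suc m * suc m) + x
  expand = solve-∀

mutual
  size-universal : ∀ f k → suc k ≤ f → size (universal f (suc k)) ≤ suc k * suc k
  size-universal (suc f) k (s≤s k≤f) = ≤-trans
    (size-spine f ⌊ k /2⌋ _ (≤-trans (⌊n/2⌋≤n k) k≤f))
    (≤-trans (+-monoʳ-≤ _ (size-bottom f ⌈ k /2⌉ (≤-trans (⌈n/2⌉≤n k) k≤f)))
             (universal-size-step k ⌊ k /2⌋ ⌈ k /2⌉ (halves-squares k)))

  size-universal-≤ : ∀ f m → m ≤ f → size (universal f m) ≤ m * m + 1
  size-universal-≤ zero    zero    _   = ≤-refl
  size-universal-≤ (suc f) zero    _   = ≤-refl
  size-universal-≤ f       (suc k) k≤f = ≤-trans (size-universal f k k≤f) (m≤m+n _ 1)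

  size-bottom : ∀ f c → c ≤ f → size (bottom f c) ≤ suc (2 * (c * c))
  size-bottom f zero    _   = ≤-refl
  size-bottom f (suc c) c≤f = begin
    size (bottom f (suc c))             ≡⟨ size-node₂ U U ⟩
    suc (size U + size U)               ≤⟨ s≤s (+-mono-≤ (size-universal f c c≤f) (size-universal f c c≤f)) ⟩
    suc (suc c * suc c + suc c * suc c) ≡⟨ cong (λ n → suc (suc c * suc c + n)) (sym (+-identityʳ _)) ⟩
    suc (2 * (suc c * suc c))           ∎
    where
    open ≤-Reasoning
    U : Tree
    U = universal f (suc c)

  size-spine : ∀ f m X → m ≤ f → size (spine f m X) ≤ 2 * (m * m) + size X
  size-spine zero    m       X _   = m≤n+m (size X) (2 * (m * m))
  size-spine (suc f) zero    X _   = ≤-refl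
  size-spine (suc f) (suc m) X (s≤s m≤f) = begin
    size (spine f a Y)                                      ≤⟨ size-spine f a Y a≤f ⟩
    2 * (a * a) + size Y                                    ≡⟨ cong (2 * (a * a) +_) (size-node₂ U Z) ⟩
    2 * (a * a) + suc (size U + size Z)                     ≤⟨ +-monoʳ-≤ (2 * (a * a)) (s≤s children) ⟩
    2 * (a * a) + suc ((m * m + 1) + (2 * (b * b) + size X)) ≤⟨ spine-size-step m a b (size X) (halves-squares m) ⟩
    2 * (suc m * suc m) + size X                            ∎
    where
    open ≤-Reasoning
    a b : ℕ
    a = ⌊ m /2⌋
    b = ⌈ m /2⌉
    a≤f : a ≤ f
    a≤f = ≤-trans (⌊n/2⌋≤n m) m≤f
    b≤f : b ≤ f
    b≤f = ≤-trans (⌈n/2⌉≤n m) m≤f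
    U Z Y : Tree
    U = universal f m
    Z = spine f b X
    Y = node (U ∷ Z ∷ [])
    children : size U + size Z ≤ (m * m + 1) + (2 * (b * b) + size X)
    children = +-mono-≤ (size-universal-≤ f m m≤f) (size-spine f b X b≤f)

theorem3 : (n : ℕ) → 1 ≤ n →
    Σ Tree (λ S → (size S ≤ n * n) × NCAUniversalBinary n S)
theorem3 (suc k) _ =
  universal (suc k) (suc k) ,
  size-universal (suc k) k ≤-refl ,
  λ T binary small → universal-embedding (suc k) (suc k) ≤-refl binary small
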